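{- Let $2\le k\le n$ and $0\le r\le n$. Let $S$ be a totally ordered set with $|S|=n$ and $C$ a division of $S$ with $(|C_1|,\dots,|C_n|)=(0^{k-2},r,n-r,0^{n-k})$. Let $\lambda\notin S$ be an element adjoined to the order so that $\lambda>s$ for all $s\in C_{k-1}$ and $\lambda<s$ for all $s\in C_k$. Then a permutation $w=w_1\dots w_n$ of $S$ is a $C$-permutation if and only if the sequence $\lambda,w_1,\dots,w_n$ has exactly $k-1$ descents.
   Context: $0^l$ denotes $l$ zeros. A descent of a sequence $a_1,a_2,\dots$ is an index $i$ with $a_i>a_{i+1}$. A division of $S$ is a sequence $C=(C_1,\dots,C_n)$ of pairwise disjoint (possibly empty) sets with union $S$ and $s<t$ whenever $s\in C_i,t\in C_j,i<j$. An element $s$ is admissible w.r.t. $C$ if it is the smallest element of $C_1$, the largest element of $C_n$, or lies in $C_i$ with $i\ne1,n$. For admissible $s\in C_i$, with $C_i^-=\{t\in C_i:t<s\}$, $C_i^+=\{t\in C_i:t>s\}$, the deletion $C^s$ is: if $i=1$, $(C_1^+\cup C_2,C_3,\dots,C_n)$; if $i\ne1,n$, $(C_1,\dots,C_{i-2},C_{i-1}\cup C_i^-,C_i^+\cup C_{i+1},C_{i+2},\dots,C_n)$; if $i=n$, $(C_1,\dots,C_{n-2},C_{n-1}\cup C_n^-)$. A $C$-permutation is an ordering $w_1\dots w_n$ of $S$ such that $w_1$ is admissible w.r.t. $C$, $w_2$ w.r.t. $C^{w_1}$, $w_3$ w.r.t. $(C^{w_1})^{w_2}$, and so on (a single remaining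 element of a one-set division is admissible). -}

module Defs where

open import Level using (0ℓ)
open import Data.Nat using (ℕ; zero; suc; _+_; _<_)
open import Data.Fin using (Fin; zero; suc; toℕ)
open import Data.Vec using (Vec; []; _∷_; lookup)
open import Data.List using (List; []; _∷_)
open import Data.List.Membership.Propositional using (_∈_; _∉_)
open import Data.List.Relation.Unary.Unique.Propositional using (Unique)
open import Data.Product using (_×_; Σ)
open import Data.Sum using (_⊎_)
open import Relation.Nullary using (¬_)
open import Relation.Unary using (Pred; _∪_)
open import Relation.Binary using (Rel; Tri; tri<; tri≈; tri>)
open import Relation.Binary.Structures using (IsStrictTotalOrder)
open import Relation.Binary.PropositionalEquality using (_≡_; _≢_)
open import Function.Bundles using (_⇔_)

record IsDivision {A : Set} (_≺_ : Rel A 0ℓ) {m : ℕ} (S : List A) (C : Vec (List A) m) : Set where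
  field
    blocksUnique : ∀ i → Unique (lookup C i)
    disjoint     : ∀ i j x → i ≢ j → x ∈ lookup C i → x ∉ lookup C j
    union        : ∀ x → x ∈ S ⇔ Σ (Fin m) (λ i → x ∈ lookup C i)
    ordered      : ∀ i j s t → toℕ i < toℕ j → s ∈ lookup C i → t ∈ lookup C j → s ≺ t

setOf : {A : Set} → List A → Pred A 0ℓ
setOf L x = x ∈ L

module _ {A : Set} (_≺_ : Rel A 0ℓ) where

  below : Pred A 0ℓ → A → Pred A 0ℓ
  below P s t = P t × t ≺ s

  above : Pred A 0ℓ → A → Pred A 0ℓ
  above P s t = P t × s ≺ t

  -- s is admissible w.r.t. division C, lying in block i (0-based index)
  Admissible : {m : ℕ} → Vec (Pred A 0ℓ) m → Fin m → A → Set
  Admissible {m} C i s =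
    lookup C i s ×
    ( (toℕ i ≡ 0 × (∀ t → lookup C i t → s ≡ t ⊎ s ≺ t))
    ⊎ (suc (toℕ i) ≡ m × (∀ t → lookup C i t → s ≡ t ⊎ t ≺ s))
    ⊎ (toℕ i ≢ 0 × suc (toℕ i) ≢ m))

  delete : {m : ℕ} → Vec (Pred A 0ℓ) (suc (suc m)) → Fin (suc (suc m)) → A → Vec (Pred A 0ℓ) (suc m)
  delete (P ∷ Q ∷ Cs) zero s = (above P s ∪ Q) ∷ Cs
  delete (P ∷ Q ∷ []) (suc zero) s = (P ∪ below Q s) ∷ []
  delete (P ∷ Q ∷ R ∷ Cs) (suc zero) s = (P ∪ below Q s) ∷ (above Q s ∪ R) ∷ Cs
  delete (P ∷ Q ∷ R ∷ Cs) (suc (suc i)) s = P ∷ delete (Q ∷ R ∷ Cs) (suc i) s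

  data CPerm : {m : ℕ} → Vec (Pred A 0ℓ) m → List A → Set₁ where
    single : ∀ {P : Pred A 0ℓ} {s} → Admissible (P ∷ []) zero s → CPerm (P ∷ []) (s ∷ [])
    step   : ∀ {m} {C : Vec (Pred A 0ℓ) (suc (suc m))} {i s w} →
             Admissible C i s → CPerm (delete C i s) w → CPerm C (s ∷ w)

descents : {A : Set} {_≺_ : Rel A 0ℓ} → IsStrictTotalOrder _≡_ _≺_ → List A → ℕ
descents sto [] = 0
descents {A} sto (a ∷ l) = go a l
  where
  isDesc : A → A → ℕ
  isDesc a b with IsStrictTotalOrder.compare sto b a
  ... | tri< _ _ _ = 1
  ... | tri≈ _ _ _ = 0
  ... | tri> _ _ _ = 0
  go : A → List A → ℕ
  go a [] = 0
  go a (b ∷ l) = isDesc a b + go b l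

-- Let μ be the letter just before the part w of the word still to be read (initially μ = λ).  The
-- current division is always the split of w at μ: its only nonempty blocks are the letters of w below
-- μ, immediately followed by those above μ, the upper ones in block a.  Deleting the next letter s
-- gives the split of the rest at s, in position a - 1 if s < μ (a descent) and a otherwise; and s is
-- admissible exactly when that position is not ruled out by the letters left (position 0 needs all of
-- them above s, the last position all of them below s).  By induction, a counts the descents of μ w.

module Submission where

open import Defs
open import Level using (0ℓ)
open import Data.Nat using (ℕ; zero; suc; _+_; _≤_; _<_; _∸_; z≤n; s≤s; _≟_)
open import Data.Nat.Properties
  using ( <-cmp; m≤n⇒m<n∨m≡n; ≤-refl; n≤1+n; ≤-trans; ≤-pred; +-mono-≤; <⇒≱
        ; suc-injective; 0≢1+n; 1+n≢n; 1+n≰n)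
open import Data.Fin using (Fin; zero; suc; toℕ; inject₁; fromℕ<)
open import Data.Fin.Properties using (toℕ-inject₁; toℕ-fromℕ<; toℕ-injective)
open import Data.Vec using (Vec; []; _∷_; lookup; toList)
open import Data.Vec.Properties using (lookup-map)
open import Data.List using (List; []; _∷_; length; map; replicate; _++_)
open import Data.List.Properties using (∷-injectiveˡ; ∷-injectiveʳ)
open import Data.List.Membership.Propositional using (_∈_; _∉_)
open import Data.List.Relation.Unary.Any using (here; there)
open import Data.List.Relation.Unary.All.Properties using (All¬⇒¬Any)
open import Data.List.Relation.Unary.All using (_∷_)
open import Data.List.Relation.Unary.AllPairs using (_∷_; tail)
open import Data.List.Relation.Unary.Unique.Propositional using (Unique)
open import Data.List.Relation.Binary.Permutation.Propositional using (_↭_; ↭-sym; ↭⇒↭ₛ)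
open import Data.List.Relation.Binary.Permutation.Propositional.Properties using (∈-resp-↭; ↭-length)
import Data.List.Relation.Binary.Permutation.Setoid.Properties as Permutationₛ
open import Data.Product using (_×_; _,_; proj₁; proj₂)
open import Data.Sum using (_⊎_; inj₁; inj₂) renaming (map to ⊎-map)
open import Data.Empty using (⊥-elim)
open import Function using (_∘_)
open import Relation.Nullary using (yes; no)
open import Relation.Unary using (Pred; _∪_)
open import Relation.Binary using (Rel; tri<; tri≈; tri>)
open import Relation.Binary.Structures using (IsStrictTotalOrder)
open import Relation.Binary.PropositionalEquality
  using (_≡_; _≢_; refl; sym; trans; cong; subst; setoid; module ≡-Reasoning)
open import Function.Bundles using (_⇔_; mk⇔; Equivalence)

open Equivalence using (to; from)

data Offset (j i : ℕ) : Set where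
  far-below  : suc j < i → Offset j i
  just-below : suc j ≡ i → Offset j i
  same       : j ≡ i → Offset j i
  higher     : i < j → Offset j i

offset : ∀ j i → Offset j i
offset j i with <-cmp j i
... | tri≈ _ j≡i _ = same j≡i
... | tri> _ _ i<j = higher i<j
... | tri< j<i _ _ with m≤n⇒m<n∨m≡n j<i
...   | inj₁ 1+j<i = far-below 1+j<i
...   | inj₂ 1+j≡i = just-below 1+j≡i

module _ {A : Set} where

  unique-resp-↭ : {xs ys : List A} → xs ↭ ys → Unique xs → Unique ys
  unique-resp-↭ p = Permutationₛ.Unique-resp-↭ (setoid A) (↭⇒↭ₛ p)

  head-∉ : ∀ {s} {w : List A} → Unique (s ∷ w) → s ∉ w
  head-∉ (s∉w ∷ _) = All¬⇒¬Any s∉w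

  ∈-tail : ∀ {x s} {w : List A} → x ∈ s ∷ w → x ≢ s → x ∈ w
  ∈-tail (here x≡s) x≢s = ⊥-elim (x≢s x≡s)
  ∈-tail (there x∈w) _ = x∈w

  length≡0⇒∉ : ∀ {X : List A} {x} → length X ≡ 0 → x ∉ X
  length≡0⇒∉ {_ ∷ _} ()

  blocks-empty : ∀ {m t} (C : Vec (List A) m) → map length (toList C) ≡ replicate t 0 →
                 ∀ j {x} → x ∉ lookup C j
  blocks-empty {t = zero}  (X ∷ C) ()
  blocks-empty {t = suc t} (X ∷ C) sizes zero    = length≡0⇒∉ (∷-injectiveˡ sizes)
  blocks-empty {t = suc t} (X ∷ C) sizes (suc j) = blocks-empty C (∷-injectiveʳ sizes) j

  nonempty-blocks : ∀ {m} p {r q t} (C : Vec (List A) m) →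
                    map length (toList C) ≡ replicate p 0 ++ r ∷ q ∷ replicate t 0 →
                    ∀ j {x} → x ∈ lookup C j → toℕ j ≡ p ⊎ toℕ j ≡ suc p
  nonempty-blocks zero    (X ∷ C)     sizes zero             _  = inj₁ refl
  nonempty-blocks zero    (X ∷ Y ∷ C) sizes (suc zero)       _  = inj₂ refl
  nonempty-blocks zero    (X ∷ Y ∷ C) sizes (suc (suc j))    x∈ =
    ⊥-elim (blocks-empty C (∷-injectiveʳ (∷-injectiveʳ sizes)) j x∈)
  nonempty-blocks (suc p) (X ∷ C)     sizes zero             x∈ =
    ⊥-elim (length≡0⇒∉ (∷-injectiveˡ sizes) x∈)
  nonempty-blocks (suc p) (X ∷ C)     sizes (suc j)          x∈ =
    ⊎-map (cong suc) (cong suc) (nonempty-blocks p C (∷-injectiveʳ sizes) j x∈)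

module _ {A : Set} (_≺_ : Rel A 0ℓ) where

  delete-lookup-far-below : ∀ {m} (C : Vec (Pred A 0ℓ) (suc (suc m))) i s (j : Fin (suc m)) →
                            suc (toℕ j) < toℕ i →
                            lookup (delete _≺_ C i s) j ≡ lookup C (inject₁ j)
  delete-lookup-far-below (P ∷ Q ∷ Cs)     zero          s j       ()
  delete-lookup-far-below (P ∷ Q ∷ Cs)     (suc zero)    s j       (s≤s ())
  delete-lookup-far-below (P ∷ Q ∷ R ∷ Cs) (suc (suc i)) s zero    _         = refl
  delete-lookup-far-below (P ∷ Q ∷ R ∷ Cs) (suc (suc i)) s (suc j) (s≤s j<i) =
    delete-lookup-far-below (Q ∷ R ∷ Cs) (suc i) s j j<i

  delete-lookup-just-below : ∀ {m} (C : Vec (Pred A 0ℓ) (suc (suc m))) i s (j : Fin (suc m)) →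
                             suc (toℕ j) ≡ toℕ i →
                             lookup (delete _≺_ C i s) j ≡
                             (lookup C (inject₁ j) ∪ below _≺_ (lookup C i) s)
  delete-lookup-just-below (P ∷ Q ∷ [])     (suc zero)    s zero    _ = refl
  delete-lookup-just-below (P ∷ Q ∷ R ∷ Cs) (suc zero)    s zero    _ = refl
  delete-lookup-just-below (P ∷ Q ∷ R ∷ Cs) (suc (suc i)) s (suc j) e =
    delete-lookup-just-below (Q ∷ R ∷ Cs) (suc i) s j (suc-injective e)

  delete-lookup-same : ∀ {m} (C : Vec (Pred A 0ℓ) (suc (suc m))) i s (j : Fin (suc m)) →
                       toℕ j ≡ toℕ i →
                       lookup (delete _≺_ C i s) j ≡ (above _≺_ (lookup C i) s ∪ lookup C (suc j))
  delete-lookup-same (P ∷ Q ∷ Cs)     zero          s zero       _ = refl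
  delete-lookup-same (P ∷ Q ∷ R ∷ Cs) (suc zero)    s (suc zero) _ = refl
  delete-lookup-same (P ∷ Q ∷ R ∷ Cs) (suc (suc i)) s (suc j)    e =
    delete-lookup-same (Q ∷ R ∷ Cs) (suc i) s j (suc-injective e)

  delete-lookup-higher : ∀ {m} (C : Vec (Pred A 0ℓ) (suc (suc m))) i s (j : Fin (suc m)) →
                         toℕ i < toℕ j → lookup (delete _≺_ C i s) j ≡ lookup C (suc j)
  delete-lookup-higher (P ∷ Q ∷ Cs)     zero          s (suc j)       _         = refl
  delete-lookup-higher (P ∷ Q ∷ R ∷ Cs) (suc zero)    s (suc zero)    (s≤s ())
  delete-lookup-higher (P ∷ Q ∷ R ∷ Cs) (suc zero)    s (suc (suc j)) _         = refl
  delete-lookup-higher (P ∷ Q ∷ R ∷ Cs) (suc (suc i)) s (suc j)       (s≤s i<j) =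
    delete-lookup-higher (Q ∷ R ∷ Cs) (suc i) s j i<j

  LowerBound UpperBound : Pred A 0ℓ → A → Set
  LowerBound P s = ∀ t → P t → s ≡ t ⊎ s ≺ t
  UpperBound P s = ∀ t → P t → s ≡ t ⊎ t ≺ s

  BoundedInBlock : ∀ {m} → Vec (Pred A 0ℓ) (suc (suc m)) → Fin (suc (suc m)) → A → Set
  BoundedInBlock {m} C i s =
    lookup C i s × (toℕ i ≡ 0 → LowerBound (lookup C i) s)
                 × (toℕ i ≡ suc m → UpperBound (lookup C i) s)

  -- Needs two blocks at least: with a single block, Admissible asks for a lower bound only.
  admissible⇔boundedInBlock : ∀ {m} (C : Vec (Pred A 0ℓ) (suc (suc m))) i s →
                              Admissible _≺_ C i s ⇔ BoundedInBlock C i s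
  admissible⇔boundedInBlock {m} C i s = mk⇔ forward backward
    where
    forward : Admissible _≺_ C i s → BoundedInBlock C i s
    forward (p , inj₁ (i≡0 , lower)) =
      p , (λ _ → lower) , λ i≡1+m → ⊥-elim (0≢1+n (trans (sym i≡0) i≡1+m))
    forward (p , inj₂ (inj₁ (1+i≡2+m , upper))) =
      p , (λ i≡0 → ⊥-elim (0≢1+n (trans (sym i≡0) (suc-injective 1+i≡2+m)))) , λ _ → upper
    forward (p , inj₂ (inj₂ (i≢0 , 1+i≢2+m))) =
      p , ⊥-elim ∘ i≢0 , ⊥-elim ∘ 1+i≢2+m ∘ cong suc
    backward : BoundedInBlock C i s → Admissible _≺_ C i s
    backward (p , lower , upper) with toℕ i ≟ 0 | toℕ i ≟ suc m
    ... | yes i≡0 | _          = p , inj₁ (i≡0 , lower i≡0)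
    ... | no _    | yes i≡1+m  = p , inj₂ (inj₁ (cong suc i≡1+m , upper i≡1+m))
    ... | no i≢0  | no i≢1+m   = p , inj₂ (inj₂ (i≢0 , i≢1+m ∘ suc-injective))

module _ {A : Set} {_≺_ : Rel A 0ℓ} (sto : IsStrictTotalOrder _≡_ _≺_) where
  open IsStrictTotalOrder sto using (compare; irrefl; asym) renaming (trans to ≺-trans)

  ≺⇒≢ : ∀ {x y} → x ≺ y → x ≢ y
  ≺⇒≢ x≺y refl = irrefl refl x≺y

  descent : A → A → ℕ
  descent a b with compare b a
  ... | tri< _ _ _ = 1
  ... | tri≈ _ _ _ = 0
  ... | tri> _ _ _ = 0

  descents-∷ : ∀ a b l → descents sto (a ∷ b ∷ l) ≡ descent a b + descents sto (b ∷ l)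
  descents-∷ a b []      with compare b a
  ... | tri< _ _ _ = refl
  ... | tri≈ _ _ _ = refl
  ... | tri> _ _ _ = refl
  descents-∷ a b (_ ∷ _) with compare b a
  ... | tri< _ _ _ = refl
  ... | tri≈ _ _ _ = refl
  ... | tri> _ _ _ = refl

  descent≤1 : ∀ a b → descent a b ≤ 1
  descent≤1 a b with compare b a
  ... | tri< _ _ _ = ≤-refl
  ... | tri≈ _ _ _ = z≤n
  ... | tri> _ _ _ = z≤n

  descents≤length : ∀ a l → descents sto (a ∷ l) ≤ length l
  descents≤length a []      = z≤n
  descents≤length a (b ∷ l) rewrite descents-∷ a b l =
    +-mono-≤ (descent≤1 a b) (descents≤length b l)

  EndConditions : A → ℕ → List A → Set
  EndConditions μ a w =
    (a ≡ 0 → ∀ x → x ∈ w → μ ≺ x) × (a ≡ length w → ∀ x → x ∈ w → x ≺ μ)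

  descents-endConditions : ∀ {μ} w → Unique (μ ∷ w) → EndConditions μ (descents sto (μ ∷ w)) w
  descents-endConditions []      _ = (λ _ _ ()) , (λ _ _ ())
  descents-endConditions {μ} (b ∷ w) ((μ≢b ∷ _) ∷ u) with compare b μ | descents-endConditions w u
  ... | tri< b≺μ _ _ | _ , all-below = (λ ()) , λ d≡ → λ
    { _ (here refl)  → b≺μ
    ; x (there x∈w) → ≺-trans (all-below (suc-injective d≡) x x∈w) b≺μ }
  ... | tri≈ _ b≡μ _ | _ = ⊥-elim (μ≢b (sym b≡μ))
  ... | tri> _ _ μ≺b | all-above , _ = (λ d≡0 → λ
    { _ (here refl)  → μ≺b
    ; x (there x∈w) → ≺-trans μ≺b (all-above d≡0 x x∈w) })
    , λ d≡ → ⊥-elim (1+n≰n (subst (_≤ length w) d≡ (descents≤length b w)))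

  SplitBlock : A → ℕ → ℕ → A → Set
  SplitBlock μ a J x = (suc J ≡ a × x ≺ μ) ⊎ (J ≡ a × μ ≺ x)

  IsSplit : ∀ {m} → Vec (Pred A 0ℓ) m → A → ℕ → List A → Set
  IsSplit C μ a w = ∀ j x → lookup C j x ⇔ (x ∈ w × SplitBlock μ a (toℕ j) x)

  splitBlock-bounds : ∀ {μ a J x} → SplitBlock μ a J x → J ≤ a × a ≤ suc J
  splitBlock-bounds (inj₁ (refl , _)) = n≤1+n _ , ≤-refl
  splitBlock-bounds (inj₂ (refl , _)) = ≤-refl , n≤1+n _

  splitBlock-functional : ∀ {μ a J J′ x} → SplitBlock μ a J x → SplitBlock μ a J′ x → J ≡ J′
  splitBlock-functional (inj₁ (e , _))   (inj₁ (e′ , _))  = suc-injective (trans e (sym e′))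
  splitBlock-functional (inj₁ (_ , x≺μ)) (inj₂ (_ , μ≺x)) = ⊥-elim (asym x≺μ μ≺x)
  splitBlock-functional (inj₂ (_ , μ≺x)) (inj₁ (_ , x≺μ)) = ⊥-elim (asym x≺μ μ≺x)
  splitBlock-functional (inj₂ (e , _))   (inj₂ (e′ , _))  = trans e (sym e′)

  splitBlock⇔descent : ∀ {μ a J x} → x ≢ μ → SplitBlock μ a J x ⇔ descent μ x + J ≡ a
  splitBlock⇔descent {μ} {a} {J} {x} x≢μ = mk⇔ forward backward
    where
    forward : SplitBlock μ a J x → descent μ x + J ≡ a
    forward x-block with compare x μ | x-block
    ... | tri< _ _ _   | inj₁ (e , _)   = e
    ... | tri< x≺μ _ _ | inj₂ (_ , μ≺x) = ⊥-elim (asym x≺μ μ≺x)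
    ... | tri≈ _ x≡μ _ | _              = ⊥-elim (x≢μ x≡μ)
    ... | tri> _ _ μ≺x | inj₁ (_ , x≺μ) = ⊥-elim (asym x≺μ μ≺x)
    ... | tri> _ _ _   | inj₂ (e , _)   = e
    backward : descent μ x + J ≡ a → SplitBlock μ a J x
    backward with compare x μ
    ... | tri< x≺μ _ _ = λ e → inj₁ (e , x≺μ)
    ... | tri≈ _ x≡μ _ = ⊥-elim (x≢μ x≡μ)
    ... | tri> _ _ μ≺x = λ e → inj₂ (e , μ≺x)

  split-inject₁ : ∀ {m μ a w} {C : Vec (Pred A 0ℓ) (suc m)} → IsSplit C μ a w →
                  ∀ j x → lookup C (inject₁ j) x ⇔ (x ∈ w × SplitBlock μ a (toℕ j) x)
  split-inject₁ {μ = μ} {a} {w} {C} split j x =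
    subst (λ J → lookup C (inject₁ j) x ⇔ (x ∈ w × SplitBlock μ a J x)) (toℕ-inject₁ j)
          (split (inject₁ j) x)

  module _ {m μ a s w} {C : Vec (Pred A 0ℓ) (suc (suc m))} {i : Fin (suc (suc m))}
           (μ∉ : μ ∉ s ∷ w) (split : IsSplit C μ a (s ∷ w))
           (s-block : SplitBlock μ a (toℕ i) s) where

    split-delete-just-below : ∀ j x → suc (toℕ j) ≡ toℕ i →
                              (lookup C (inject₁ j) ∪ below _≺_ (lookup C i) s) x ⇔
                              (x ∈ w × SplitBlock s (toℕ i) (toℕ j) x)
    split-delete-just-below j x 1+j≡i = mk⇔ (forward s-block) (backward s-block)
      where
      forward : SplitBlock μ a (toℕ i) s → (lookup C (inject₁ j) ∪ below _≺_ (lookup C i) s) x →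
                x ∈ w × SplitBlock s (toℕ i) (toℕ j) x
      forward _ (inj₂ (x∈Ci , x≺s)) =
        ∈-tail (proj₁ (to (split i x) x∈Ci)) (≺⇒≢ x≺s) , inj₁ (1+j≡i , x≺s)
      forward s-blk (inj₁ x∈Cj) with to (split-inject₁ {C = C} split j x) x∈Cj | s-blk
      ... | x∈ , inj₁ (_ , x≺μ)  | inj₂ (_ , μ≺s)   =
        ∈-tail x∈ (≺⇒≢ (≺-trans x≺μ μ≺s)) , inj₁ (1+j≡i , ≺-trans x≺μ μ≺s)
      ... | _ , inj₁ (1+j≡a , _) | inj₁ (1+i≡a , _) =
        ⊥-elim (1+n≢n (trans (cong suc 1+j≡i) (trans 1+i≡a (sym 1+j≡a))))
      ... | _ , inj₂ (j≡a , _)   | s-blk′           =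
        ⊥-elim (1+n≰n (subst (_≤ toℕ j) (sym 1+j≡i)
                             (subst (toℕ i ≤_) (sym j≡a) (proj₁ (splitBlock-bounds s-blk′)))))
      backward : SplitBlock μ a (toℕ i) s → x ∈ w × SplitBlock s (toℕ i) (toℕ j) x →
                 (lookup C (inject₁ j) ∪ below _≺_ (lookup C i) s) x
      backward _ (_ , inj₂ (j≡i , _)) = ⊥-elim (1+n≢n (trans 1+j≡i (sym j≡i)))
      backward s-blk (x∈w , inj₁ (_ , x≺s)) with compare x μ | s-blk
      ... | tri< x≺μ _ _  | inj₁ (1+i≡a , _) =
        inj₂ (from (split i x) (there x∈w , inj₁ (1+i≡a , x≺μ)) , x≺s)
      ... | tri< x≺μ _ _  | inj₂ (i≡a , _)   =
        inj₁ (from (split-inject₁ {C = C} split j x) (there x∈w , inj₁ (trans 1+j≡i i≡a , x≺μ)))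
      ... | tri≈ _ refl _ | _                = ⊥-elim (μ∉ (there x∈w))
      ... | tri> _ _ μ≺x  | inj₁ (_ , s≺μ)   =
        ⊥-elim (irrefl refl (≺-trans s≺μ (≺-trans μ≺x x≺s)))
      ... | tri> _ _ μ≺x  | inj₂ (i≡a , _)   =
        inj₂ (from (split i x) (there x∈w , inj₂ (i≡a , μ≺x)) , x≺s)

    split-delete-same : ∀ j x → toℕ j ≡ toℕ i →
                        (above _≺_ (lookup C i) s ∪ lookup C (suc j)) x ⇔
                        (x ∈ w × SplitBlock s (toℕ i) (toℕ j) x)
    split-delete-same j x j≡i = mk⇔ (forward s-block) (backward s-block)
      where
      forward : SplitBlock μ a (toℕ i) s → (above _≺_ (lookup C i) s ∪ lookup C (suc j)) x →
                x ∈ w × SplitBlock s (toℕ i) (toℕ j) x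
      forward _ (inj₁ (x∈Ci , s≺x)) =
        ∈-tail (proj₁ (to (split i x) x∈Ci)) (≺⇒≢ s≺x ∘ sym) , inj₂ (j≡i , s≺x)
      forward s-blk (inj₂ x∈C1+j) with to (split (suc j) x) x∈C1+j | s-blk
      ... | x∈ , inj₂ (_ , μ≺x)  | inj₁ (_ , s≺μ) =
        ∈-tail x∈ (≺⇒≢ (≺-trans s≺μ μ≺x) ∘ sym) , inj₂ (j≡i , ≺-trans s≺μ μ≺x)
      ... | _ , inj₂ (1+j≡a , _) | inj₂ (i≡a , _) =
        ⊥-elim (1+n≢n (trans 1+j≡a (trans (sym i≡a) (sym j≡i))))
      ... | _ , inj₁ (2+j≡a , _) | s-blk′         =
        ⊥-elim (1+n≰n (subst (λ J → 2 + toℕ j ≤ suc J) (sym j≡i)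
                             (subst (_≤ suc (toℕ i)) (sym 2+j≡a) (proj₂ (splitBlock-bounds s-blk′)))))
      backward : SplitBlock μ a (toℕ i) s → x ∈ w × SplitBlock s (toℕ i) (toℕ j) x →
                 (above _≺_ (lookup C i) s ∪ lookup C (suc j)) x
      backward _ (_ , inj₁ (1+j≡i , _)) = ⊥-elim (1+n≢n (trans 1+j≡i (sym j≡i)))
      backward s-blk (x∈w , inj₂ (_ , s≺x)) with compare x μ | s-blk
      ... | tri< x≺μ _ _  | inj₁ (1+i≡a , _) =
        inj₁ (from (split i x) (there x∈w , inj₁ (1+i≡a , x≺μ)) , s≺x)
      ... | tri< x≺μ _ _  | inj₂ (_ , μ≺s)   =
        ⊥-elim (irrefl refl (≺-trans μ≺s (≺-trans s≺x x≺μ)))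
      ... | tri≈ _ refl _ | _                = ⊥-elim (μ∉ (there x∈w))
      ... | tri> _ _ μ≺x  | inj₁ (1+i≡a , _) =
        inj₂ (from (split (suc j) x) (there x∈w , inj₂ (trans (cong suc j≡i) 1+i≡a , μ≺x)))
      ... | tri> _ _ μ≺x  | inj₂ (i≡a , _)   =
        inj₁ (from (split i x) (there x∈w , inj₂ (i≡a , μ≺x)) , s≺x)

    -- Away from block i both sides are empty: a split only fills the two blocks next to its position.
    split-delete : IsSplit (delete _≺_ C i s) s (toℕ i) w
    split-delete j x with offset (toℕ j) (toℕ i)
    ... | just-below 1+j≡i rewrite delete-lookup-just-below _≺_ C i s j 1+j≡i =
      split-delete-just-below j x 1+j≡i
    ... | same j≡i         rewrite delete-lookup-same _≺_ C i s j j≡i =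
      split-delete-same j x j≡i
    ... | far-below 1+j<i  rewrite delete-lookup-far-below _≺_ C i s j 1+j<i = mk⇔
      (λ x∈Cj → too-low (≤-trans (proj₁ (splitBlock-bounds s-block))
                                 (proj₂ (splitBlock-bounds (proj₂ (to (split-inject₁ {C = C} split j x)
                                                                      x∈Cj))))))
      (λ (_ , x-block) → too-low (proj₂ (splitBlock-bounds x-block)))
      where
      too-low : {B : Set} → toℕ i ≤ suc (toℕ j) → B
      too-low = ⊥-elim ∘ <⇒≱ 1+j<i
    ... | higher i<j       rewrite delete-lookup-higher _≺_ C i s j i<j = mk⇔
      (λ x∈C1+j → too-high (≤-pred (≤-trans
        (proj₁ (splitBlock-bounds (proj₂ (to (split (suc j) x) x∈C1+j))))
        (proj₂ (splitBlock-bounds s-block)))))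
      (λ (_ , x-block) → too-high (proj₁ (splitBlock-bounds x-block)))
      where
      too-high : {B : Set} → toℕ j ≤ toℕ i → B
      too-high = ⊥-elim ∘ <⇒≱ i<j

  module _ {m μ a s w} {C : Vec (Pred A 0ℓ) m} {i : Fin m}
           (unique : Unique (s ∷ w)) (μ∉ : μ ∉ s ∷ w) (split : IsSplit C μ a (s ∷ w))
           (ends : EndConditions μ a (s ∷ w)) (s-block : SplitBlock μ a (toℕ i) s) where

    private
      strictly-above : ∀ {x} → x ∈ w → s ≡ x ⊎ s ≺ x → s ≺ x
      strictly-above x∈w (inj₁ refl) = ⊥-elim (head-∉ unique x∈w)
      strictly-above _   (inj₂ s≺x)  = s≺x

      strictly-below : ∀ {x} → x ∈ w → s ≡ x ⊎ x ≺ s → x ≺ s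
      strictly-below x∈w (inj₁ refl) = ⊥-elim (head-∉ unique x∈w)
      strictly-below _   (inj₂ x≺s)  = x≺s

    split-lowerBound : toℕ i ≡ 0 → LowerBound _≺_ (lookup C i) s ⇔ (∀ x → x ∈ w → s ≺ x)
    split-lowerBound i≡0 = mk⇔ (forward s-block) backward
      where
      forward : SplitBlock μ a (toℕ i) s → LowerBound _≺_ (lookup C i) s →
                ∀ x → x ∈ w → s ≺ x
      forward s-blk lower x x∈w with compare x μ | s-blk
      ... | tri< x≺μ _ _  | inj₁ (1+i≡a , _) =
        strictly-above x∈w (lower x (from (split i x) (there x∈w , inj₁ (1+i≡a , x≺μ))))
      ... | tri< x≺μ _ _  | inj₂ (i≡a , _)   =
        ⊥-elim (asym x≺μ (proj₁ ends (trans (sym i≡a) i≡0) x (there x∈w)))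
      ... | tri≈ _ refl _ | _                = ⊥-elim (μ∉ (there x∈w))
      ... | tri> _ _ μ≺x  | inj₁ (_ , s≺μ)   = ≺-trans s≺μ μ≺x
      ... | tri> _ _ μ≺x  | inj₂ (i≡a , _)   =
        strictly-above x∈w (lower x (from (split i x) (there x∈w , inj₂ (i≡a , μ≺x))))
      backward : (∀ x → x ∈ w → s ≺ x) → LowerBound _≺_ (lookup C i) s
      backward all-above t t∈Ci with proj₁ (to (split i t) t∈Ci)
      ... | here refl = inj₁ refl
      ... | there t∈w = inj₂ (all-above t t∈w)

    split-upperBound : toℕ i ≡ length w →
                       UpperBound _≺_ (lookup C i) s ⇔ (∀ x → x ∈ w → x ≺ s)
    split-upperBound i≡|w| = mk⇔ (forward s-block) backward
      where
      forward : SplitBlock μ a (toℕ i) s → UpperBound _≺_ (lookup C i) s →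
                ∀ x → x ∈ w → x ≺ s
      forward s-blk upper x x∈w with compare x μ | s-blk
      ... | tri< x≺μ _ _  | inj₁ (1+i≡a , _) =
        strictly-below x∈w (upper x (from (split i x) (there x∈w , inj₁ (1+i≡a , x≺μ))))
      ... | tri< x≺μ _ _  | inj₂ (_ , μ≺s)   = ≺-trans x≺μ μ≺s
      ... | tri≈ _ refl _ | _                = ⊥-elim (μ∉ (there x∈w))
      ... | tri> _ _ μ≺x  | inj₁ (1+i≡a , _) =
        ⊥-elim (asym μ≺x (proj₂ ends (trans (sym 1+i≡a) (cong suc i≡|w|)) x (there x∈w)))
      ... | tri> _ _ μ≺x  | inj₂ (i≡a , _)   =
        strictly-below x∈w (upper x (from (split i x) (there x∈w , inj₂ (i≡a , μ≺x))))
      backward : (∀ x → x ∈ w → x ≺ s) → UpperBound _≺_ (lookup C i) s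
      backward all-below t t∈Ci with proj₁ (to (split i t) t∈Ci)
      ... | here refl = inj₁ refl
      ... | there t∈w = inj₂ (all-below t t∈w)

  split-admissible⇔ : ∀ {μ a s t w} {C : Vec (Pred A 0ℓ) (length (s ∷ t ∷ w))} {i} →
                      Unique (s ∷ t ∷ w) → μ ∉ s ∷ t ∷ w → IsSplit C μ a (s ∷ t ∷ w) →
                      EndConditions μ a (s ∷ t ∷ w) → SplitBlock μ a (toℕ i) s →
                      Admissible _≺_ C i s ⇔ EndConditions s (toℕ i) (t ∷ w)
  split-admissible⇔ {s = s} {t} {w} {C} {i} unique μ∉ split ends s-block = mk⇔
    (λ adm → let (_ , lower , upper) = to (admissible⇔boundedInBlock _≺_ C i s) adm in
        (λ i≡0 → to (lowerBound⇔ i≡0) (lower i≡0))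
      , (λ i≡|w| → to (upperBound⇔ i≡|w|) (upper i≡|w|)))
    (λ (all-above , all-below) → from (admissible⇔boundedInBlock _≺_ C i s)
      ( from (split i s) (here refl , s-block)
      , (λ i≡0 → from (lowerBound⇔ i≡0) (all-above i≡0))
      , λ i≡|w| → from (upperBound⇔ i≡|w|) (all-below i≡|w|)))
    where
    lowerBound⇔ : toℕ i ≡ 0 → LowerBound _≺_ (lookup C i) s ⇔ (∀ x → x ∈ t ∷ w → s ≺ x)
    lowerBound⇔ = split-lowerBound {C = C} unique μ∉ split ends s-block
    upperBound⇔ : toℕ i ≡ length (t ∷ w) →
                  UpperBound _≺_ (lookup C i) s ⇔ (∀ x → x ∈ t ∷ w → x ≺ s)
    upperBound⇔ = split-upperBound {C = C} unique μ∉ split ends s-block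

  cperm-∷⇔descents : ∀ {μ a} s w (C : Vec (Pred A 0ℓ) (length (s ∷ w))) →
                     Unique (s ∷ w) → μ ∉ s ∷ w → IsSplit C μ a (s ∷ w) →
                     EndConditions μ a (s ∷ w) →
                     CPerm _≺_ C (s ∷ w) ⇔ descents sto (μ ∷ s ∷ w) ≡ a
  cperm-∷⇔descents {μ} {a} s [] (P ∷ []) unique μ∉ split ends = mk⇔ forward backward
    where
    s≢μ : s ≢ μ
    s≢μ refl = μ∉ (here refl)
    forward : CPerm _≺_ (P ∷ []) (s ∷ []) → descents sto (μ ∷ s ∷ []) ≡ a
    forward (single (s∈P , _)) =
      trans (descents-∷ μ s []) (to (splitBlock⇔descent s≢μ) (proj₂ (to (split zero s) s∈P)))
    backward : descents sto (μ ∷ s ∷ []) ≡ a → CPerm _≺_ (P ∷ []) (s ∷ [])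
    backward d≡a = single (from (split zero s) (here refl , s-block) , inj₁ (refl , lower))
      where
      s-block : SplitBlock μ a 0 s
      s-block = from (splitBlock⇔descent s≢μ) (trans (sym (descents-∷ μ s [])) d≡a)
      lower : LowerBound _≺_ P s
      lower = from (split-lowerBound {C = P ∷ []} unique μ∉ split ends s-block refl) λ _ ()
  cperm-∷⇔descents {μ} {a} s (t ∷ w) C unique μ∉ split ends = mk⇔ forward backward
    where
    open ≡-Reasoning
    s≢μ : s ≢ μ
    s≢μ refl = μ∉ (here refl)
    rest⇔ : ∀ i → SplitBlock μ a (toℕ i) s → EndConditions s (toℕ i) (t ∷ w) →
            CPerm _≺_ (delete _≺_ C i s) (t ∷ w) ⇔ descents sto (s ∷ t ∷ w) ≡ toℕ i
    rest⇔ i s-block = cperm-∷⇔descents t w (delete _≺_ C i s) (tail unique) (head-∉ unique)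
                                        (split-delete {C = C} μ∉ split s-block)
    forward : CPerm _≺_ C (s ∷ t ∷ w) → descents sto (μ ∷ s ∷ t ∷ w) ≡ a
    forward (step {i = i} adm rest) = begin
      descents sto (μ ∷ s ∷ t ∷ w)
        ≡⟨ descents-∷ μ s (t ∷ w) ⟩
      descent μ s + descents sto (s ∷ t ∷ w)
        ≡⟨ cong (descent μ s +_) (to (rest⇔ i s-block ends′) rest) ⟩
      descent μ s + toℕ i
        ≡⟨ to (splitBlock⇔descent s≢μ) s-block ⟩
      a ∎
      where
      s-block : SplitBlock μ a (toℕ i) s
      s-block = proj₂ (to (split i s) (proj₁ adm))
      ends′ : EndConditions s (toℕ i) (t ∷ w)
      ends′ = to (split-admissible⇔ {C = C} unique μ∉ split ends s-block) adm
    backward : descents sto (μ ∷ s ∷ t ∷ w) ≡ a → CPerm _≺_ C (s ∷ t ∷ w)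
    backward d≡a = step adm (from (rest⇔ i s-block ends′) (sym i≡d))
      where
      i : Fin (length (s ∷ t ∷ w))
      i = fromℕ< (s≤s (descents≤length s (t ∷ w)))
      i≡d : toℕ i ≡ descents sto (s ∷ t ∷ w)
      i≡d = toℕ-fromℕ< (s≤s (descents≤length s (t ∷ w)))
      s-block : SplitBlock μ a (toℕ i) s
      s-block = from (splitBlock⇔descent s≢μ) (begin
        descent μ s + toℕ i                    ≡⟨ cong (descent μ s +_) i≡d ⟩
        descent μ s + descents sto (s ∷ t ∷ w) ≡⟨ sym (descents-∷ μ s (t ∷ w)) ⟩
        descents sto (μ ∷ s ∷ t ∷ w)           ≡⟨ d≡a ⟩
        a                                      ∎)
      ends′ : EndConditions s (toℕ i) (t ∷ w)
      ends′ = subst (λ d → EndConditions s d (t ∷ w)) (sym i≡d)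
                    (descents-endConditions (t ∷ w) unique)
      adm : Admissible _≺_ C i s
      adm = from (split-admissible⇔ {C = C} unique μ∉ split ends s-block) ends′

  cperm⇔descents : ∀ {m μ a} w (C : Vec (Pred A 0ℓ) (suc m)) → length w ≡ suc m →
                   Unique w → μ ∉ w → IsSplit C μ a w → EndConditions μ a w →
                   CPerm _≺_ C w ⇔ descents sto (μ ∷ w) ≡ a
  cperm⇔descents (s ∷ w) C refl = cperm-∷⇔descents s w C

  division-split : ∀ {n} (b : ℕ) {r q t : ℕ} {S w : List A} {μ} (C : Vec (List A) n) →
                   IsDivision _≺_ S C → w ↭ S →
                   map length (toList C) ≡ replicate b 0 ++ r ∷ q ∷ replicate t 0 →
                   (∀ j x → x ∈ lookup C j →
                     (2 + toℕ j ≡ 2 + b → x ≺ μ) × (1 + toℕ j ≡ 2 + b → μ ≺ x)) →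
                   IsSplit (Data.Vec.map setOf C) μ (suc b) w
  division-split b {w = w} {μ} C division w↭S sizes around-μ j x rewrite lookup-map j setOf C =
    mk⇔ (λ x∈Cj → ∈w j x∈Cj , block j x∈Cj) backward
    where
    open IsDivision division using (union)
    ∈w : ∀ j {x} → x ∈ lookup C j → x ∈ w
    ∈w j {x} x∈Cj = ∈-resp-↭ (↭-sym w↭S) (from (union x) (j , x∈Cj))
    block : ∀ j {x} → x ∈ lookup C j → SplitBlock μ (suc b) (toℕ j) x
    block j x∈Cj with nonempty-blocks b C sizes j x∈Cj
    ... | inj₁ j≡b   = inj₁ (cong suc j≡b , proj₁ (around-μ j _ x∈Cj) (cong (2 +_) j≡b))
    ... | inj₂ j≡1+b = inj₂ (j≡1+b , proj₂ (around-μ j _ x∈Cj) (cong suc j≡1+b))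
    backward : x ∈ w × SplitBlock μ (suc b) (toℕ j) x → x ∈ lookup C j
    backward (x∈w , x-block) with to (union x) (∈-resp-↭ w↭S x∈w)
    ... | i , x∈Ci =
      subst (λ k → x ∈ lookup C k) (toℕ-injective (splitBlock-functional (block i x∈Ci) x-block)) x∈Ci

mainTheorem9 : (A : Set) (_≺_ : Rel A 0ℓ) (sto : IsStrictTotalOrder _≡_ _≺_)
    (n k r : ℕ) → 2 ≤ k → k ≤ n → r ≤ n →
    (S : List A) → Unique S → length S ≡ n →
    (C : Vec (List A) n) → IsDivision _≺_ S C →
    map length (toList C) ≡ replicate (k ∸ 2) 0 ++ r ∷ (n ∸ r) ∷ replicate (n ∸ k) 0 →
    (λ₀ : A) → λ₀ ∉ S →
    (∀ j s → s ∈ lookup C j →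
      (suc (suc (toℕ j)) ≡ k → s ≺ λ₀) × (suc (toℕ j) ≡ k → λ₀ ≺ s)) →
    (w : List A) → w ↭ S →
    (CPerm _≺_ (Data.Vec.map setOf C) w ⇔ (descents sto (λ₀ ∷ w) ≡ k ∸ 1))
mainTheorem9 A _≺_ sto (suc (suc n)) (suc (suc b)) _ (s≤s (s≤s z≤n)) (s≤s (s≤s b≤n)) _
             S S-unique |S|≡n C division sizes λ₀ λ₀∉S around-λ₀ w w↭S =
  cperm⇔descents sto w (Data.Vec.map setOf C) |w|≡n w-unique λ₀∉w split ends
  where
  |w|≡n : length w ≡ suc (suc n)
  |w|≡n = trans (↭-length w↭S) |S|≡n
  w-unique : Unique w
  w-unique = unique-resp-↭ (↭-sym w↭S) S-unique
  λ₀∉w : λ₀ ∉ w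
  λ₀∉w = λ₀∉S ∘ ∈-resp-↭ w↭S
  split : IsSplit sto (Data.Vec.map setOf C) λ₀ (suc b) w
  split = division-split sto b C division w↭S sizes around-λ₀
  ends : EndConditions sto λ₀ (suc b) w
  ends = (λ ()) , λ 1+b≡|w| →
    ⊥-elim (1+n≰n (subst (_≤ n) (suc-injective (trans 1+b≡|w| |w|≡n)) b≤n))
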